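{- There is a constant $C$ such that for every $N\ge 1$ and every nonempty submatrix $B$ of the $N\times N$ index grid, the quadtree over the $N\times N$ grid satisfies $|I(B)|\le CN$; that is, $|I(B)|=O(N)$.
   Context: The quadtree over the $N\times N$ grid $\{0,\dots,N-1\}^2$ is the rooted tree of "nodes", each covering a submatrix $[x_0,x_1][y_0,y_1]=\{(x,y):x_0\le x\le x_1,\ y_0\le y\le y_1\}$, defined as follows: the root covers $[0,N-1][0,N-1]$; a node covering $[x_0,x_1][y_0,y_1]$ with more than one element has as children the nodes covering the nonempty ones among $[x_0,x_m][y_0,y_m]$, $[x_m+1,x_1][y_0,y_m]$, $[x_0,x_m][y_m+1,y_1]$, $[x_m+1,x_1][y_m+1,y_1]$, where $x_m=\lfloor(x_0+x_1)/2\rfloor$, $y_m=\lfloor(y_0+y_1)/2\rfloor$; single-element nodes are leaves. For a submatrix $B$, $S(B)$ is the smallest set of pairwise disjoint quadtree nodes whose union is $B$ (the maximal nodes contained in $B$), and $I(B)=\bigcup_{n\in S(B)}\{m : m \text{ a node},\ m\supseteq n\}$. -}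

module Defs where

open import Data.Nat using (ℕ; _+_; _∸_; _≤_; _<_; _/_)
open import Data.Product using (_×_; Σ; ∃; _,_)
open import Data.Sum using (_⊎_)
open import Relation.Binary.PropositionalEquality using (_≡_; _≢_)

record Rect : Set where
  constructor rect
  field
    x0 x1 y0 y1 : ℕ
open Rect public

_∈R_ : ℕ × ℕ → Rect → Set
(x , y) ∈R r = (x0 r ≤ x × x ≤ x1 r) × (y0 r ≤ y × y ≤ y1 r)

_⊆R_ : Rect → Rect → Set
r ⊆R s = ∀ p → p ∈R r → p ∈R s

NonemptyR : Rect → Set
NonemptyR r = ∃ λ p → p ∈R r

MoreThanOne : Rect → Set
MoreThanOne r = Σ (ℕ × ℕ) λ p → Σ (ℕ × ℕ) λ q → p ∈R r × q ∈R r × p ≢ q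

xm ym : Rect → ℕ
xm r = (x0 r + x1 r) / 2
ym r = (y0 r + y1 r) / 2

IsQuadrant : Rect → Rect → Set
IsQuadrant r c =
    c ≡ rect (x0 r) (xm r) (y0 r) (ym r)
  ⊎ c ≡ rect (xm r + 1) (x1 r) (y0 r) (ym r)
  ⊎ c ≡ rect (x0 r) (xm r) (ym r + 1) (y1 r)
  ⊎ c ≡ rect (xm r + 1) (x1 r) (ym r + 1) (y1 r)

-- Nodes of the quadtree over the N × N grid, identified with the
-- submatrices they cover (distinct nodes cover distinct submatrices).
data Node (N : ℕ) : Rect → Set where
  root  : Node N (rect 0 (N ∸ 1) 0 (N ∸ 1))
  child : ∀ {r c} → Node N r → MoreThanOne r → IsQuadrant r c →
          NonemptyR c → Node N c

IsSubmatrix : ℕ → Rect → Set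
IsSubmatrix N b = (x0 b ≤ x1 b × x1 b < N) × (y0 b ≤ y1 b × y1 b < N)

InS : ℕ → Rect → Rect → Set
InS N b n = Node N n × n ⊆R b ×
            (∀ m → Node N m → n ⊆R m → m ⊆R b → m ≡ n)

InI : ℕ → Rect → Rect → Set
InI N b m = Node N m × ∃ λ n → InS N b n × n ⊆R m

-- Every node m of I(B) meets B, and by maximality of the nodes of S(B) the only node a with
-- m ⊆ a ⊆ B is m itself. So I(B) is contained in the list of rectangles met when descending from the
-- root, discarding rectangles disjoint from B and stopping at rectangles inside B. A rectangle that is
-- split meets B without lying inside it, so one of the four lines bounding B crosses it. Give a
-- rectangle crossed by a line the potential (x1 - x0) + (y1 - y0): only the (at most two) quadrants on
-- one side of the midpoint can be crossed, and as each has at most half the width, their potentials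
-- add up to less than the parent's. Summed over the four lines the potential therefore drops by at
-- least one at every split, so at most 1 + 4 · 4 · 2(N - 1) ≤ 32 N rectangles are listed.

module Submission where

open import Defs
open import Data.Bool using (true; false; if_then_else_)
open import Data.Empty using (⊥-elim)
open import Data.List using (List; []; _∷_; length; concatMap)
open import Data.List.Properties using (length-++; length-removeAt′)
open import Data.List.Membership.Propositional using (_∈_; lose)
open import Data.List.Membership.Propositional.Properties using (∈-concatMap⁺)
open import Data.List.Relation.Unary.All as All using (All; []; _∷_)
open import Data.List.Relation.Unary.AllPairs using ([]; _∷_)
open import Data.List.Relation.Unary.Any as Any using (Any; here; there; _─_; index)
open import Data.List.Relation.Unary.Unique.Propositional using (Unique)
open import Data.Nat using (ℕ; zero; suc; pred; _+_; _*_; _∸_; _≤_; _<_; _⊔_; z≤n; s≤s; _≤?_; _<?_)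
open import Data.Nat.Divisibility using (divides)
open import Data.Nat.DivMod using (_/_; _%_; m≡m%n+[m/n]*n; m%n<n; /-congˡ; +-distrib-/-∣ʳ; m*n/n≡m; m/n≤m)
open import Data.Nat.Properties
open import Algebra.Properties.CommutativeSemigroup +-commutativeSemigroup using (interchange; x∙yz≈y∙xz)
open import Data.Nat.Tactic.RingSolver using (solve-∀)
open import Data.Product using (∃; _×_; _,_; proj₁; proj₂)
open import Data.Sum using (inj₁; inj₂)
open import Function using (_∘_)
open import Relation.Binary.Construct.Closure.ReflexiveTransitive using (Star; ε; _◅_; _◅◅_)
open import Relation.Binary.PropositionalEquality using (_≡_; _≢_; refl; sym; trans; cong; cong₂; subst)
open import Relation.Nullary using (Dec; yes; no; does; ¬_; contradiction)
open import Relation.Nullary.Decidable using (_×-dec_; dec-true; dec-false)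

open ≤-Reasoning

private
  variable
    A B : Set

∑ : List A → (A → ℕ) → ℕ
∑ []       f = 0
∑ (x ∷ xs) f = f x + ∑ xs f

syntax ∑ xs (λ x → e) = ∑[ x ∈ xs ] e

∑-distrib-+ : ∀ (xs : List A) f g → ∑[ x ∈ xs ] (f x + g x) ≡ ∑ xs f + ∑ xs g
∑-distrib-+ []       f g = refl
∑-distrib-+ (x ∷ xs) f g =
  trans (cong (f x + g x +_) (∑-distrib-+ xs f g)) (interchange (f x) (g x) (∑ xs f) (∑ xs g))

∑-distribˡ-* : ∀ k (xs : List A) f → ∑[ x ∈ xs ] (k * f x) ≡ k * ∑ xs f
∑-distribˡ-* k []       f = sym (*-zeroʳ k)
∑-distribˡ-* k (x ∷ xs) f =
  trans (cong (k * f x +_) (∑-distribˡ-* k xs f)) (sym (*-distribˡ-+ k (f x) (∑ xs f)))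

∑-zero : ∀ (xs : List A) → ∑[ x ∈ xs ] 0 ≡ 0
∑-zero []       = refl
∑-zero (x ∷ xs) = ∑-zero xs

∑-comm : ∀ (xs : List A) (ys : List B) (f : A → B → ℕ) →
         ∑[ x ∈ xs ] ∑[ y ∈ ys ] f x y ≡ ∑[ y ∈ ys ] ∑[ x ∈ xs ] f x y
∑-comm []       ys f = sym (∑-zero ys)
∑-comm (x ∷ xs) ys f =
  trans (cong (∑ ys (f x) +_) (∑-comm xs ys f))
        (sym (∑-distrib-+ ys (f x) (λ y → ∑[ x ∈ xs ] f x y)))

∑-mono-≤ : ∀ {xs : List A} {f g} → All (λ x → f x ≤ g x) xs → ∑ xs f ≤ ∑ xs g
∑-mono-≤ []           = z≤n
∑-mono-≤ (fx≤gx ∷ ps) = +-mono-≤ fx≤gx (∑-mono-≤ ps)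

∑-mono-< : ∀ {xs : List A} {f g} → All (λ x → f x ≤ g x) xs →
           Any (λ x → f x < g x) xs → ∑ xs f < ∑ xs g
∑-mono-< (_     ∷ ps) (here fx<gx) = +-mono-<-≤ fx<gx (∑-mono-≤ ps)
∑-mono-< (fx≤gx ∷ ps) (there p)    = +-mono-≤-< fx≤gx (∑-mono-< ps p)

length-concatMap : ∀ (g : A → List B) xs → length (concatMap g xs) ≡ ∑[ x ∈ xs ] length (g x)
length-concatMap g []       = refl
length-concatMap g (x ∷ xs) = trans (length-++ (g x)) (cong (length (g x) +_) (length-concatMap g xs))

Eventually : (ℕ → Set) → Set
Eventually P = ∃ λ n → ∀ {m} → n ≤ m → P m

All-eventually : ∀ {P : ℕ → A → Set} {xs} →
                 All (λ x → Eventually (λ f → P f x)) xs → Eventually (λ f → All (P f) xs)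
All-eventually [] = 0 , λ _ → []
All-eventually ((f , Pf) ∷ rest) with All-eventually rest
... | g , Pg = f ⊔ g , λ f⊔g≤h → Pf (≤-trans (m≤m⊔n f g) f⊔g≤h) ∷ Pg (≤-trans (m≤n⊔m f g) f⊔g≤h)

∈-─ : ∀ {x y : A} {ys} (x∈ys : x ∈ ys) → y ∈ ys → y ≢ x → y ∈ (ys ─ x∈ys)
∈-─ (here refl)  (here y≡x)   y≢x = ⊥-elim (y≢x y≡x)
∈-─ (here refl)  (there y∈ys) _   = y∈ys
∈-─ (there _)    (here y≡z)   _   = here y≡z
∈-─ (there x∈ys) (there y∈ys) y≢x = there (∈-─ x∈ys y∈ys y≢x)

length-unique-≤ : ∀ {xs ys : List A} → Unique xs → All (_∈ ys) xs → length xs ≤ length ys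
length-unique-≤ [] [] = z≤n
length-unique-≤ {xs = x ∷ xs} {ys} (x∉xs ∷ xs!) (x∈ys ∷ xs⊆ys) = begin
  suc (length xs)           ≤⟨ s≤s (length-unique-≤ xs! xs⊆ys─x) ⟩
  suc (length (ys ─ x∈ys))  ≡⟨ length-removeAt′ ys (index x∈ys) ⟨
  length ys                 ∎
  where
  xs⊆ys─x : All (_∈ (ys ─ x∈ys)) xs
  xs⊆ys─x = All.zipWith (λ (y∈ys , x≢y) → ∈-─ x∈ys y∈ys (x≢y ∘ sym)) (xs⊆ys , x∉xs)

half-bounds : ∀ d → d / 2 + d / 2 ≤ d × d ≤ suc (d / 2 + d / 2)
half-bounds d = subst (h + h ≤_) (sym d≡) (m≤n+m (h + h) (d % 2))
              , subst (_≤ suc (h + h)) (sym d≡) (+-monoˡ-≤ (h + h) (≤-pred (m%n<n d 2)))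
  where
  h : ℕ
  h = d / 2
  d≡ : d ≡ d % 2 + (h + h)
  d≡ = trans (m≡m%n+[m/n]*n d 2) (cong (d % 2 +_) (trans (*-comm h 2) (cong (h +_) (+-identityʳ h))))

mid≡ : ∀ {a b} → a ≤ b → (a + b) / 2 ≡ a + (b ∸ a) / 2
mid≡ {a} {b} a≤b = begin-equality
  (a + b) / 2              ≡⟨ /-congˡ (cong (a +_) (m+[n∸m]≡n a≤b)) ⟨
  (a + (a + d)) / 2        ≡⟨ /-congˡ (rearrange a d) ⟩
  (d + a * 2) / 2          ≡⟨ +-distrib-/-∣ʳ d (divides a refl) ⟩
  d / 2 + a * 2 / 2        ≡⟨ cong (d / 2 +_) (m*n/n≡m a 2) ⟩
  d / 2 + a                ≡⟨ +-comm (d / 2) a ⟩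
  a + d / 2                ∎
  where
  d : ℕ
  d = b ∸ a
  rearrange : ∀ a d → a + (a + d) ≡ d + a * 2
  rearrange = solve-∀

≤mid : ∀ {a b} → a ≤ b → a ≤ (a + b) / 2
≤mid {a} a≤b = subst (a ≤_) (sym (mid≡ a≤b)) (m≤m+n a _)

≤mid+1 : ∀ {a b} → a ≤ b → a ≤ (a + b) / 2 + 1
≤mid+1 a≤b = ≤-trans (≤mid a≤b) (m≤m+n _ 1)

mid≤ : ∀ {a b} → a ≤ b → (a + b) / 2 ≤ b
mid≤ {a} {b} a≤b = begin
  (a + b) / 2        ≡⟨ mid≡ a≤b ⟩
  a + (b ∸ a) / 2    ≤⟨ +-monoʳ-≤ a (m/n≤m (b ∸ a) 2) ⟩
  a + (b ∸ a)        ≡⟨ m+[n∸m]≡n a≤b ⟩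
  b                  ∎

lower-half-doubled : ∀ {a b} → a ≤ b → ((a + b) / 2 ∸ a) + ((a + b) / 2 ∸ a) ≤ b ∸ a
lower-half-doubled {a} {b} a≤b rewrite mid≡ a≤b | m+n∸m≡n a ((b ∸ a) / 2) = proj₁ (half-bounds (b ∸ a))

upper-half-doubled : ∀ {a b} → a ≤ b → (b ∸ ((a + b) / 2 + 1)) + (b ∸ ((a + b) / 2 + 1)) ≤ b ∸ a
upper-half-doubled {a} {b} a≤b = subst (λ u → u + u ≤ d) (sym u≡) (begin
  (d ∸ suc h) + (d ∸ suc h)  ≤⟨ +-mono-≤ u≤h u≤h ⟩
  h + h                      ≤⟨ proj₁ (half-bounds d) ⟩
  d                          ∎)
  where
  d h : ℕ
  d = b ∸ a
  h = d / 2
  u≤h : d ∸ suc h ≤ h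
  u≤h = m≤n+o⇒m∸n≤o d (suc h) (proj₂ (half-bounds d))
  u≡ : b ∸ ((a + b) / 2 + 1) ≡ d ∸ suc h
  u≡ = begin-equality
    b ∸ ((a + b) / 2 + 1)  ≡⟨ cong (λ m → b ∸ (m + 1)) (mid≡ a≤b) ⟩
    b ∸ (a + h + 1)        ≡⟨ cong (b ∸_) (trans (+-assoc a h 1) (cong (a +_) (+-comm h 1))) ⟩
    b ∸ (a + suc h)        ≡⟨ ∸-+-assoc b a (suc h) ⟨
    d ∸ suc h              ∎

∸-split-< : ∀ {a m b} → a ≤ m → m < b → (m ∸ a) + (b ∸ (m + 1)) < b ∸ a
∸-split-< {a} {m} {b} a≤m m<b = begin-strict
  (m ∸ a) + (b ∸ (m + 1))        <⟨ m<m+n _ (s≤s z≤n) ⟩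
  (m ∸ a) + (b ∸ (m + 1)) + 1    ≡⟨ +-assoc (m ∸ a) _ 1 ⟩
  (m ∸ a) + (b ∸ (m + 1) + 1)    ≡⟨ cong (λ x → (m ∸ a) + (x + 1)) (∸-+-assoc b m 1) ⟨
  (m ∸ a) + (b ∸ m ∸ 1 + 1)      ≡⟨ cong ((m ∸ a) +_) (m∸n+n≡m (m<n⇒0<n∸m m<b)) ⟩
  (m ∸ a) + (b ∸ m)              ≡⟨ +-∸-comm (b ∸ m) a≤m ⟨
  (m + (b ∸ m)) ∸ a              ≡⟨ cong (_∸ a) (m+[n∸m]≡n (<⇒≤ m<b)) ⟩
  b ∸ a                          ∎

m+m≤n⇒m<n : ∀ {m n} → m + m ≤ n → 0 < n → m < n
m+m≤n⇒m<n {zero}  _     0<n = 0<n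
m+m≤n⇒m<n {suc m} 2m≤n  _   = <-≤-trans (m<m+n (suc m) (s≤s z≤n)) 2m≤n

m+1≤n⇒m<n : ∀ {m n} → m + 1 ≤ n → m < n
m+1≤n⇒m<n {m} {n} = subst (_≤ n) (+-comm m 1)

pred-between : ∀ {a c b} → a < c → c ≤ b → a ≤ pred c × pred c < b
pred-between (s≤s a≤c) c≤b = a≤c , c≤b

width height size : Rect → ℕ
width  r = x1 r ∸ x0 r
height r = y1 r ∸ y0 r
size   r = width r + height r

transpose : Rect → Rect
transpose r = rect (y0 r) (y1 r) (x0 r) (x1 r)

q₁ q₂ q₃ q₄ : Rect → Rect
q₁ r = rect (x0 r) (xm r) (y0 r) (ym r)
q₂ r = rect (xm r + 1) (x1 r) (y0 r) (ym r)
q₃ r = rect (x0 r) (xm r) (ym r + 1) (y1 r)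
q₄ r = rect (xm r + 1) (x1 r) (ym r + 1) (y1 r)

quadrants : Rect → List Rect
quadrants r = q₁ r ∷ q₂ r ∷ q₃ r ∷ q₄ r ∷ []

∈-quadrants : ∀ {r c} → IsQuadrant r c → c ∈ quadrants r
∈-quadrants (inj₁ refl)               = here refl
∈-quadrants (inj₂ (inj₁ refl))        = there (here refl)
∈-quadrants (inj₂ (inj₂ (inj₁ refl))) = there (there (here refl))
∈-quadrants (inj₂ (inj₂ (inj₂ refl))) = there (there (there (here refl)))

∑-quadrants-transpose : ∀ (f : Rect → ℕ) r →
                        ∑[ q ∈ quadrants r ] f (transpose q) ≡ ∑[ q ∈ quadrants (transpose r) ] f q
∑-quadrants-transpose f r = cong (f (q₁ (transpose r)) +_) (x∙yz≈y∙xz (f (q₃ (transpose r))) (f (q₂ (transpose r))) (f (q₄ (transpose r)) + 0))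

infix 4 _⊑_

_⊑_ : Rect → Rect → Set
r ⊑ s = (x0 s ≤ x0 r × x1 r ≤ x1 s) × (y0 s ≤ y0 r × y1 r ≤ y1 s)

_⊑?_ : ∀ r s → Dec (r ⊑ s)
r ⊑? s = ((x0 s ≤? x0 r) ×-dec (x1 r ≤? x1 s)) ×-dec ((y0 s ≤? y0 r) ×-dec (y1 r ≤? y1 s))

⊑⇒⊆R : ∀ {r s} → r ⊑ s → r ⊆R s
⊑⇒⊆R ((x0≤ , ≤x1) , (y0≤ , ≤y1)) _ ((x0≤x , x≤x1) , (y0≤y , y≤y1)) =
  (≤-trans x0≤ x0≤x , ≤-trans x≤x1 ≤x1) , (≤-trans y0≤ y0≤y , ≤-trans y≤y1 ≤y1)

quadrant-⊑ : ∀ {r c} → x0 r ≤ x1 r → y0 r ≤ y1 r → IsQuadrant r c → c ⊑ r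
quadrant-⊑ x y (inj₁ refl)               = (≤-refl   , mid≤ x)  , (≤-refl   , mid≤ y)
quadrant-⊑ x y (inj₂ (inj₁ refl))        = (≤mid+1 x , ≤-refl)  , (≤-refl   , mid≤ y)
quadrant-⊑ x y (inj₂ (inj₂ (inj₁ refl))) = (≤-refl   , mid≤ x)  , (≤mid+1 y , ≤-refl)
quadrant-⊑ x y (inj₂ (inj₂ (inj₂ refl))) = (≤mid+1 x , ≤-refl)  , (≤mid+1 y , ≤-refl)

quadrants-⊑ : ∀ {r} → x0 r ≤ x1 r → y0 r ≤ y1 r → All (_⊑ r) (quadrants r)
quadrants-⊑ x y = quadrant-⊑ x y (inj₁ refl) ∷ quadrant-⊑ x y (inj₂ (inj₁ refl))
                ∷ quadrant-⊑ x y (inj₂ (inj₂ (inj₁ refl))) ∷ quadrant-⊑ x y (inj₂ (inj₂ (inj₂ refl))) ∷ []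

-- Potentials of lines

-- vertical c runs between the columns c and c + 1, horizontal c between the rows c and c + 1.
data Line : Set where
  vertical horizontal : ℕ → Line

Crosses : Line → Rect → Set
Crosses (vertical c)   r = (x0 r ≤ c × c < x1 r) × y0 r ≤ y1 r
Crosses (horizontal c) r = Crosses (vertical c) (transpose r)

crosses? : ∀ ℓ r → Dec (Crosses ℓ r)
crosses? (vertical c)   r = ((x0 r ≤? c) ×-dec (c <? x1 r)) ×-dec (y0 r ≤? y1 r)
crosses? (horizontal c) r = crosses? (vertical c) (transpose r)

potential : Line → Rect → ℕ
potential (vertical c)   r = if does (crosses? (vertical c) r) then size r else 0
potential (horizontal c) r = potential (vertical c) (transpose r)

potential≤size : ∀ ℓ r → potential ℓ r ≤ size r
potential≤size (vertical c) r with does (crosses? (vertical c) r)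
... | true  = ≤-refl
... | false = z≤n
potential≤size (horizontal c) r =
  subst (potential (horizontal c) r ≤_) (+-comm (height r) (width r)) (potential≤size (vertical c) (transpose r))

potential-crossing : ∀ {c r} → Crosses (vertical c) r → potential (vertical c) r ≡ size r
potential-crossing {c} {r} cr rewrite dec-true (crosses? (vertical c) r) cr = refl

potential-noncrossing : ∀ {c r} → ¬ Crosses (vertical c) r → potential (vertical c) r ≡ 0
potential-noncrossing {c} {r} ¬cr rewrite dec-false (crosses? (vertical c) r) ¬cr = refl

crosses-⊑ : ∀ {c q r} → q ⊑ r → Crosses (vertical c) q → Crosses (vertical c) r
crosses-⊑ ((x0≤ , ≤x1) , (y0≤ , ≤y1)) ((x0≤c , c<x1) , y0≤y1) =
  (≤-trans x0≤ x0≤c , <-≤-trans c<x1 ≤x1) , ≤-trans y0≤ (≤-trans y0≤y1 ≤y1)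

module _ (c : ℕ) (r : Rect) (a b : ℕ) where
  private
    ψ : Rect → ℕ
    ψ = potential (vertical c)
    w : ℕ
    w = b ∸ a
    lower upper : Rect
    lower = rect a b (y0 r) (ym r)
    upper = rect a b (ym r + 1) (y1 r)

  column-< : x0 r < x1 r → y0 r ≤ y1 r → w + w ≤ width r → ψ lower + ψ upper < size r
  column-< x0<x1 y0≤y1 2w≤width with ym r <? y1 r
  ... | yes ym<y1 = begin-strict
    ψ lower + ψ upper                                ≤⟨ +-mono-≤ (potential≤size (vertical c) lower) (potential≤size (vertical c) upper) ⟩
    (w + (ym r ∸ y0 r)) + (w + (y1 r ∸ (ym r + 1)))  ≡⟨ interchange w _ w _ ⟩
    (w + w) + ((ym r ∸ y0 r) + (y1 r ∸ (ym r + 1)))  <⟨ +-mono-≤-< 2w≤width (∸-split-< (≤mid y0≤y1) ym<y1) ⟩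
    size r                                           ∎
  ... | no ym≮y1 = begin-strict
    ψ lower + ψ upper   ≡⟨ cong (ψ lower +_) (potential-noncrossing {r = upper} (ym≮y1 ∘ m+1≤n⇒m<n ∘ proj₂)) ⟩
    ψ lower + 0         ≡⟨ +-identityʳ _ ⟩
    ψ lower             ≤⟨ potential≤size (vertical c) lower ⟩
    w + (ym r ∸ y0 r)   <⟨ +-mono-<-≤ (m+m≤n⇒m<n 2w≤width (m<n⇒0<n∸m x0<x1)) (∸-monoˡ-≤ (y0 r) (mid≤ y0≤y1)) ⟩
    size r              ∎

vertical-∑-quadrants-< : ∀ {c r} → Crosses (vertical c) r →
                         ∑[ q ∈ quadrants r ] potential (vertical c) q < potential (vertical c) r
vertical-∑-quadrants-< {c} {r} cr@((x0≤c , c<x1) , y0≤y1) with c <? xm r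
... | yes c<xm = begin-strict
  ψ (q₁ r) + (ψ (q₂ r) + (ψ (q₃ r) + (ψ (q₄ r) + 0)))
    ≡⟨ cong₂ (λ u v → ψ (q₁ r) + (u + (ψ (q₃ r) + (v + 0)))) (potential-noncrossing {r = q₂ r} right) (potential-noncrossing {r = q₄ r} right) ⟩
  ψ (q₁ r) + (ψ (q₃ r) + 0)  ≡⟨ cong (ψ (q₁ r) +_) (+-identityʳ _) ⟩
  ψ (q₁ r) + ψ (q₃ r)        <⟨ column-< c r (x0 r) (xm r) x0<x1 y0≤y1 (lower-half-doubled (<⇒≤ x0<x1)) ⟩
  size r                     ≡⟨ potential-crossing cr ⟨
  ψ r                        ∎
  where
  ψ : Rect → ℕ
  ψ = potential (vertical c)
  x0<x1 : x0 r < x1 r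
  x0<x1 = ≤-<-trans x0≤c c<x1
  right : ∀ {y0' y1'} → ¬ Crosses (vertical c) (rect (xm r + 1) (x1 r) y0' y1')
  right ((xm+1≤c , _) , _) = <-asym c<xm (m+1≤n⇒m<n xm+1≤c)
... | no c≮xm = begin-strict
  ψ (q₁ r) + (ψ (q₂ r) + (ψ (q₃ r) + (ψ (q₄ r) + 0)))
    ≡⟨ cong₂ (λ u v → u + (ψ (q₂ r) + (v + (ψ (q₄ r) + 0)))) (potential-noncrossing {r = q₁ r} left) (potential-noncrossing {r = q₃ r} left) ⟩
  ψ (q₂ r) + (ψ (q₄ r) + 0)  ≡⟨ cong (ψ (q₂ r) +_) (+-identityʳ _) ⟩
  ψ (q₂ r) + ψ (q₄ r)        <⟨ column-< c r (xm r + 1) (x1 r) x0<x1 y0≤y1 (upper-half-doubled (<⇒≤ x0<x1)) ⟩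
  size r                     ≡⟨ potential-crossing cr ⟨
  ψ r                        ∎
  where
  ψ : Rect → ℕ
  ψ = potential (vertical c)
  x0<x1 : x0 r < x1 r
  x0<x1 = ≤-<-trans x0≤c c<x1
  left : ∀ {y0' y1'} → ¬ Crosses (vertical c) (rect (x0 r) (xm r) y0' y1')
  left ((_ , c<xm) , _) = c≮xm c<xm

∑-quadrants-< : ∀ ℓ {r} → Crosses ℓ r → ∑[ q ∈ quadrants r ] potential ℓ q < potential ℓ r
∑-quadrants-< (vertical c)       cr = vertical-∑-quadrants-< cr
∑-quadrants-< (horizontal c) {r} cr = begin-strict
  ∑[ q ∈ quadrants r ] potential (vertical c) (transpose q)  ≡⟨ ∑-quadrants-transpose (potential (vertical c)) r ⟩
  ∑[ q ∈ quadrants (transpose r) ] potential (vertical c) q  <⟨ vertical-∑-quadrants-< cr ⟩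
  potential (vertical c) (transpose r)                       ∎

∑-quadrants-≤ : ∀ ℓ {r} → x0 r ≤ x1 r → y0 r ≤ y1 r → ∑[ q ∈ quadrants r ] potential ℓ q ≤ potential ℓ r
∑-quadrants-≤ (vertical c) {r} x0≤x1 y0≤y1 with crosses? (vertical c) r
... | yes cr  = <⇒≤ (vertical-∑-quadrants-< cr)
... | no ¬cr = begin
  ∑[ q ∈ quadrants r ] potential (vertical c) q  ≤⟨ ∑-mono-≤ (All.map uncrossed (quadrants-⊑ x0≤x1 y0≤y1)) ⟩
  0                                              ≡⟨ potential-noncrossing ¬cr ⟨
  potential (vertical c) r                       ∎
  where
  uncrossed : ∀ {q} → q ⊑ r → potential (vertical c) q ≤ 0
  uncrossed q⊑r = ≤-reflexive (potential-noncrossing (¬cr ∘ crosses-⊑ q⊑r))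
∑-quadrants-≤ (horizontal c) {r} x0≤x1 y0≤y1 = begin
  ∑[ q ∈ quadrants r ] potential (vertical c) (transpose q)  ≡⟨ ∑-quadrants-transpose (potential (vertical c)) r ⟩
  ∑[ q ∈ quadrants (transpose r) ] potential (vertical c) q  ≤⟨ ∑-quadrants-≤ (vertical c) y0≤y1 x0≤x1 ⟩
  potential (vertical c) (transpose r)                       ∎

-- Exploring the quadtree around a rectangle

Meets : Rect → Rect → Set
Meets r s = (x0 r ≤ x1 r × y0 r ≤ y1 r) × (x0 s ≤ x1 r × x0 r ≤ x1 s) × (y0 s ≤ y1 r × y0 r ≤ y1 s)

meets? : ∀ r s → Dec (Meets r s)
meets? r s = ((x0 r ≤? x1 r) ×-dec (y0 r ≤? y1 r))
       ×-dec ((x0 s ≤? x1 r) ×-dec (x0 r ≤? x1 s))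
       ×-dec ((y0 s ≤? y1 r) ×-dec (y0 r ≤? y1 s))

meets-at : ∀ {p r s} → p ∈R r → p ∈R s → Meets r s
meets-at ((x0≤x , x≤x1) , (y0≤y , y≤y1)) ((x0'≤x , x≤x1') , (y0'≤y , y≤y1')) =
    (≤-trans x0≤x x≤x1 , ≤-trans y0≤y y≤y1)
  , (≤-trans x0'≤x x≤x1 , ≤-trans x0≤x x≤x1')
  , (≤-trans y0'≤y y≤y1 , ≤-trans y0≤y y≤y1')

module _ (B : Rect) where

  -- pred is junk when x0 B = 0: then no rectangle sticks out to the left of B, so that line is never
  -- needed as a crossing line and merely adds a term to the potential (likewise for y0 B).
  boundary : List Line
  boundary = vertical (pred (x0 B)) ∷ vertical (x1 B) ∷ horizontal (pred (y0 B)) ∷ horizontal (y1 B) ∷ []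

  boundaryPotential : Rect → ℕ
  boundaryPotential r = ∑[ ℓ ∈ boundary ] potential ℓ r

  boundaryPotential≤ : ∀ r → boundaryPotential r ≤ 4 * size r
  boundaryPotential≤ r = ∑-mono-≤ {xs = boundary} {g = λ _ → size r} (All.tabulate (λ {ℓ} _ → potential≤size ℓ r))

  crossing-boundary : ∀ {r} → Meets r B → ¬ r ⊑ B → Any (λ ℓ → Crosses ℓ r) boundary
  crossing-boundary {r} ((x0≤x1 , y0≤y1) , (x0B≤x1 , x0≤x1B) , (y0B≤y1 , y0≤y1B)) r⋢B
    with x0 B ≤? x0 r | x1 r ≤? x1 B | y0 B ≤? y0 r | y1 r ≤? y1 B
  ... | no x0B≰x0 | _ | _ | _ = here (pred-between (≰⇒> x0B≰x0) x0B≤x1 , y0≤y1)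
  ... | yes _ | no x1≰x1B | _ | _ = there (here ((x0≤x1B , ≰⇒> x1≰x1B) , y0≤y1))
  ... | yes _ | yes _ | no y0B≰y0 | _ = there (there (here (pred-between (≰⇒> y0B≰y0) y0B≤y1 , x0≤x1)))
  ... | yes _ | yes _ | yes _ | no y1≰y1B = there (there (there (here ((y0≤y1B , ≰⇒> y1≰y1B) , x0≤x1))))
  ... | yes x0B≤x0 | yes x1≤x1B | yes y0B≤y0 | yes y1≤y1B = ⊥-elim (r⋢B ((x0B≤x0 , x1≤x1B) , (y0B≤y0 , y1≤y1B)))

  ∑-boundaryPotential-< : ∀ {r} → Meets r B → ¬ r ⊑ B →
                          ∑[ q ∈ quadrants r ] boundaryPotential q < boundaryPotential r
  ∑-boundaryPotential-< {r} r∩B@((x0≤x1 , y0≤y1) , _) r⋢B = begin-strict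
    ∑[ q ∈ quadrants r ] boundaryPotential q               ≡⟨ ∑-comm (quadrants r) boundary (λ q ℓ → potential ℓ q) ⟩
    ∑[ ℓ ∈ boundary ] ∑[ q ∈ quadrants r ] potential ℓ q   <⟨ ∑-mono-< (All.tabulate (λ {ℓ} _ → ∑-quadrants-≤ ℓ x0≤x1 y0≤y1))
                                                                        (Any.map (λ {ℓ} → ∑-quadrants-< ℓ) (crossing-boundary r∩B r⋢B)) ⟩
    boundaryPotential r                                    ∎

  explore : ℕ → Rect → List Rect
  explore zero    r = []
  explore (suc f) r with meets? r B | r ⊑? B
  ... | no  _ | _     = []
  ... | yes _ | yes _ = r ∷ []
  ... | yes _ | no  _ = r ∷ concatMap (explore f) (quadrants r)

  length-explore : ∀ f r → length (explore f r) ≤ 1 + 4 * boundaryPotential r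
  length-explore zero    r = z≤n
  length-explore (suc f) r with meets? r B | r ⊑? B
  ... | no  _   | _      = z≤n
  ... | yes _   | yes _  = s≤s z≤n
  ... | yes r∩B | no r⋢B = s≤s (begin
    length (concatMap (explore f) (quadrants r))  ≡⟨ length-concatMap (explore f) (quadrants r) ⟩
    ∑[ q ∈ quadrants r ] length (explore f q)     ≤⟨ ∑-mono-≤ {xs = quadrants r} {g = λ q → 1 + 4 * Φ q} (All.tabulate (λ {q} _ → length-explore f q)) ⟩
    ∑[ q ∈ quadrants r ] (1 + 4 * Φ q)            ≡⟨ ∑-distrib-+ (quadrants r) (λ _ → 1) (λ q → 4 * Φ q) ⟩
    4 + ∑[ q ∈ quadrants r ] (4 * Φ q)            ≡⟨ cong (4 +_) (∑-distribˡ-* 4 (quadrants r) Φ) ⟩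
    4 + 4 * ∑[ q ∈ quadrants r ] Φ q              ≡⟨ *-distribˡ-+ 4 1 _ ⟨
    4 * (1 + ∑[ q ∈ quadrants r ] Φ q)            ≤⟨ *-monoʳ-≤ 4 (∑-boundaryPotential-< r∩B r⋢B) ⟩
    4 * Φ r                                       ∎)
    where
    Φ : Rect → ℕ
    Φ = boundaryPotential

  explore-self : ∀ {f r} → Meets r B → r ∈ explore (suc f) r
  explore-self {f} {r} r∩B with meets? r B | r ⊑? B
  ... | no ¬r∩B | _     = contradiction r∩B ¬r∩B
  ... | yes _   | yes _ = here refl
  ... | yes _   | no _  = here refl

  explore-descend : ∀ {f r c x} → Meets r B → (r ⊑ B → x ≡ r) → c ∈ quadrants r →
                    x ∈ explore f c → x ∈ explore (suc f) r
  explore-descend {f} {r} r∩B stop c∈qs x∈c with meets? r B | r ⊑? B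
  ... | no ¬r∩B | _     = contradiction r∩B ¬r∩B
  ... | yes _   | yes r⊑B = here (stop r⊑B)
  ... | yes _   | no _  = there (∈-concatMap⁺ (explore f) (lose c∈qs x∈c))

-- Every node of I(B) is explored

Step : Rect → Rect → Set
Step r c = MoreThanOne r × IsQuadrant r c × NonemptyR c

MoreThanOne⇒ordered : ∀ {r} → MoreThanOne r → x0 r ≤ x1 r × y0 r ≤ y1 r
MoreThanOne⇒ordered (_ , _ , ((x0≤x , x≤x1) , (y0≤y , y≤y1)) , _) = ≤-trans x0≤x x≤x1 , ≤-trans y0≤y y≤y1

Step⇒⊆R : ∀ {r c} → Step r c → c ⊆R r
Step⇒⊆R (r>1 , q , _) = ⊑⇒⊆R (quadrant-⊑ (proj₁ (MoreThanOne⇒ordered r>1)) (proj₂ (MoreThanOne⇒ordered r>1)) q)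

Star-Step⇒⊆R : ∀ {r m} → Star Step r m → m ⊆R r
Star-Step⇒⊆R ε           p p∈m = p∈m
Star-Step⇒⊆R (s ◅ steps) p p∈m = Step⇒⊆R s p (Star-Step⇒⊆R steps p p∈m)

descent : ∀ {N m} → Node N m → Star Step (rect 0 (N ∸ 1) 0 (N ∸ 1)) m
descent root                 = ε
descent (child n r>1 q c≠∅)  = descent n ◅◅ ((r>1 , q , c≠∅) ◅ ε)

node-nonempty : ∀ {N m} → 1 ≤ N → Node N m → NonemptyR m
node-nonempty {suc _} _ root            = (0 , 0) , ((z≤n , z≤n) , (z≤n , z≤n))
node-nonempty         _ (child _ _ _ c≠∅) = c≠∅

module _ {N : ℕ} (B : Rect) {m : Rect} {z : ℕ × ℕ} (z∈m : z ∈R m) (z∈B : z ∈R B)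
         (m-topmost : ∀ a → Node N a → m ⊆R a → a ⊆R B → a ≡ m) where

  explore-complete : ∀ {r} → Node N r → Star Step r m → Eventually (λ f → m ∈ explore B f r)
  explore-complete _ ε = 1 , λ { (s≤s _) → explore-self B (meets-at z∈m z∈B) }
  explore-complete {r} node-r (step@(r>1 , q , c≠∅) ◅ steps)
    with explore-complete (child node-r r>1 q c≠∅) steps
  ... | f , explored = suc f , λ { (s≤s f≤F) → explore-descend B (meets-at (m⊆r z z∈m) z∈B) r⊑B⇒m≡r (∈-quadrants q) (explored f≤F) }
    where
    m⊆r : m ⊆R r
    m⊆r = Star-Step⇒⊆R (step ◅ steps)
    r⊑B⇒m≡r : r ⊑ B → m ≡ r
    r⊑B⇒m≡r r⊑B = sym (m-topmost r node-r m⊆r (⊑⇒⊆R r⊑B))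

InI-explored : ∀ {N B m} → 1 ≤ N → InI N B m → Eventually (λ f → m ∈ explore B f (rect 0 (N ∸ 1) 0 (N ∸ 1)))
InI-explored {N} {B} {m} 1≤N (node-m , n , (node-n , n⊆B , n-maximal) , n⊆m) with node-nonempty 1≤N node-n
... | z , z∈n = explore-complete B (n⊆m z z∈n) (n⊆B z z∈n) m-topmost root (descent node-m)
  where
  m-topmost : ∀ a → Node N a → m ⊆R a → a ⊆R B → a ≡ m
  m-topmost a node-a m⊆a a⊆B = trans (n-maximal a node-a (λ p → m⊆a p ∘ n⊆m p) a⊆B)
                                     (sym (n-maximal m node-m n⊆m (λ p → a⊆B p ∘ m⊆a p)))

theorem2 : ∃ λ (C : ℕ) → ∀ (N : ℕ) → 1 ≤ N → ∀ (b : Rect) → IsSubmatrix N b →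
             ∀ (ms : List Rect) → Unique ms → All (InI N b) ms →
             length ms ≤ C * N
-- The bound holds for every rectangle b.
theorem2 = 32 , bound
  where
  bound : ∀ N → 1 ≤ N → ∀ b → IsSubmatrix N b → ∀ ms → Unique ms → All (InI N b) ms → length ms ≤ 32 * N
  bound (suc n) 1≤N b _ ms ms! ms⊆I with All-eventually (All.map (InI-explored 1≤N) ms⊆I)
  ... | F , explored = begin
    length ms                             ≤⟨ length-unique-≤ ms! (explored ≤-refl) ⟩
    length (explore b F (rect 0 n 0 n))   ≤⟨ length-explore b F (rect 0 n 0 n) ⟩
    1 + 4 * boundaryPotential b (rect 0 n 0 n)
                                          ≤⟨ +-monoʳ-≤ 1 (*-monoʳ-≤ 4 (boundaryPotential≤ b (rect 0 n 0 n))) ⟩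
    1 + 4 * (4 * (n + n))                 ≤⟨ m≤n+m _ 31 ⟩
    31 + (1 + 4 * (4 * (n + n)))          ≡⟨ arithmetic n ⟩
    32 * suc n                            ∎
    where
    arithmetic : ∀ k → 31 + (1 + 4 * (4 * (k + k))) ≡ 32 * suc k
    arithmetic = solve-∀
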